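{- Let $q$ be a prime power, $n\ge1$, and let $F\in\mathbb{F}_{q^n}[x]$ satisfy $F^q\equiv F\pmod{x^{q^n}-x}$ and $\deg F\le q^n-1$. Then: (a) if $m$ is a monomial such that $m^q\bmod(x^{q^n}-x)$ is a monomial of $F$, then $m\bmod(x^{q^n}-x)$ is also a monomial of $F$; (b) if $m=\alpha x^{kq+1}$ is a monomial of $F$, then so is $\tilde m=\alpha^{1/q}x^{k+q^{n-1}}$.
   Context: $P\bmod (x^{q^n}-x)$ denotes the remainder of $P$ upon division by $x^{q^n}-x$; $\alpha^{1/q}$ denotes the unique $q$-th root of $\alpha$ in $\mathbb{F}_{q^n}$. "Monomial of $F$" means a nonzero term of $F$. -}

module Defs where

open import Level using (Level; _⊔_)
open import Algebra.Bundles using (CommutativeRing)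
open import Data.Nat as ℕ using (ℕ; zero; suc; _<ᵇ_; _∸_; _≤_; _^_)
open import Data.Nat.Primality using (Prime)
open import Data.Fin using (Fin)
open import Data.List using (List; []; _∷_; map; replicate; _++_; [_])
open import Data.Bool using (if_then_else_)
open import Data.Product using (Σ; ∃; _×_)
open import Relation.Nullary using (¬_)
open import Relation.Binary.PropositionalEquality using (_≡_)

IsPrimePower : ℕ → Set
IsPrimePower q = Σ ℕ λ p → Σ ℕ λ k → Prime p × 1 ≤ k × q ≡ p ^ k

module _ {c ℓ : Level} (R : CommutativeRing c ℓ) where
  open CommutativeRing R

  IsField : Set (c ⊔ ℓ)
  IsField = (¬ (1# ≈ 0#)) × (∀ x → ¬ (x ≈ 0#) → Σ Carrier λ y → x * y ≈ 1#)

  HasCard : ℕ → Set (c ⊔ ℓ)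
  HasCard N = Σ (Fin N → Carrier) λ f →
                (∀ i j → f i ≈ f j → i ≡ j) × (∀ x → Σ (Fin N) λ i → f i ≈ x)

  IsFiniteFieldOfSize : ℕ → Set (c ⊔ ℓ)
  IsFiniteFieldOfSize N = IsField × HasCard N

  -- univariate polynomials: coefficient lists, index i = coefficient of x^i
  Poly : Set c
  Poly = List Carrier

  coeff : Poly → ℕ → Carrier
  coeff []      _       = 0#
  coeff (a ∷ p) zero    = a
  coeff (a ∷ p) (suc i) = coeff p i

  _≈ₚ_ : Poly → Poly → Set ℓ
  p ≈ₚ r = ∀ i → coeff p i ≈ coeff r i

  _+ₚ_ : Poly → Poly → Poly
  []      +ₚ r       = r
  (a ∷ p) +ₚ []      = a ∷ p
  (a ∷ p) +ₚ (b ∷ r) = (a + b) ∷ (p +ₚ r)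

  _*ₚ_ : Poly → Poly → Poly
  []      *ₚ r = []
  (a ∷ p) *ₚ r = map (a *_) r +ₚ (0# ∷ (p *ₚ r))

  _^ₚ_ : Poly → ℕ → Poly
  p ^ₚ zero  = [ 1# ]
  p ^ₚ suc k = p *ₚ (p ^ₚ k)

  mon : Carrier → ℕ → Poly
  mon a e = replicate e 0# ++ [ a ]

  -- exponent reduction modulo x^N - x: x^i ≡ x^(i-(N-1)) while i ≥ N
  -- (fuel i suffices when N ≥ 2)
  redExp : ℕ → ℕ → ℕ
  redExp N i = go i i
    where
    go : ℕ → ℕ → ℕ
    go zero     j = j
    go (suc f) j = if j <ᵇ N then j else go f (j ∸ (N ∸ 1))

  -- P mod (x^N - x): the remainder of P upon division by x^N - x
  -- (for N ≥ 2: each term a·x^i is replaced by a·x^(redExp N i), which has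
  --  degree < N and is congruent to it; the sum is the remainder)
  modX : ℕ → Poly → Poly
  modX N = go 0
    where
    go : ℕ → Poly → Poly
    go i []      = []
    go i (a ∷ p) = mon a (redExp N i) +ₚ go (suc i) p

  IsTermOf : Carrier → ℕ → Poly → Set ℓ
  IsTermOf a d F = (¬ (a ≈ 0#)) × (coeff F d ≈ a)

  IsMonomialOf : Poly → Poly → Set (c ⊔ ℓ)
  IsMonomialOf P F = Σ Carrier λ a → Σ ℕ λ d → (P ≈ₚ mon a d) × IsTermOf a d F

  pow : Carrier → ℕ → Carrier
  pow x zero    = 1#
  pow x (suc k) = x * pow x k

{-# OPTIONS --safe #-}
-- Write N = q^n and M = N - 1. Reduction modulo x^N - x replaces x^j by x^(r j), where r 0 = 0 and
-- r j ∈ [1, M] with r j ≡ j (mod M); in particular it fixes polynomials of degree < N. In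
-- characteristic p the q-th power is additive, so F^q ≡ Σⱼ Fⱼ^q x^(r (j q)), and j ↦ r (j q) is
-- injective on [0, N) because q · q^(n-1) = N ≡ 1 (mod M). Hence F^q ≡ F says exactly that the
-- coefficient of x^(r (j q)) in F is Fⱼ^q. For (a) take j = r e; for (b) take j = k + q^(n-1), for
-- which r (j q) = k q + 1. Injectivity of the Frobenius map of the finite field then recovers Fⱼ
-- from Fⱼ^q.
module Submission where

open import Defs
open import Level using (Level)
open import Algebra.Bundles using (CommutativeRing; CommutativeSemiring; CommutativeMonoid)
open import Data.Nat as ℕ using (ℕ; zero; suc; z≤n; s≤s; _<_; _≤_; _∸_; _!)
import Data.Nat.Properties as ℕ
open import Data.Nat.Divisibility using (_∣_; _∤_; divides; ∣⇒≤)
open import Data.Nat.Primality using (Prime; euclidsLemma; prime⇒nonTrivial; prime⇒nonZero)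
open import Data.Nat.Combinatorics using (_C_; nCn≡1; k![n∸k]!∣n!; nCk≡n!/k![n-k]!)
open import Data.Nat.DivMod using (m/n*n≡m)
open import Data.Fin as Fin using (Fin)
open import Data.Fin.Properties using (toℕ<n; toℕ-fromℕ; toℕ-inject₁)
open import Data.List using (List; []; _∷_; map; replicate; _++_; [_]; length)
open import Data.List.Properties using (length-map)
open import Data.Product as Product using (Σ; _,_; proj₁; proj₂)
open import Data.Sum using (inj₁; inj₂)
open import Data.Empty using (⊥-elim)
open import Function using (_∘_)
open import Relation.Nullary using (¬_; Dec; yes; no)
open import Relation.Binary.PropositionalEquality as ≡ using (_≡_; _≢_)
import Relation.Binary.Reasoning.Setoid as SetoidReasoning

prime>1 : ∀ {p} → Prime p → 1 < p
prime>1 {p} p-prime = ℕ.nonTrivial⇒n>1 p {{prime⇒nonTrivial p-prime}}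

prime∤! : ∀ {p} → Prime p → ∀ m → m < p → p ∤ m !
prime∤! p-prime zero    _   p∣1 = ℕ.<⇒≱ (prime>1 p-prime) (∣⇒≤ p∣1)
prime∤! p-prime (suc m) m<p p∣m! with euclidsLemma (suc m) (m !) p-prime p∣m!
... | inj₁ p∣m = ℕ.<⇒≱ m<p (∣⇒≤ p∣m)
... | inj₂ p∣m! = prime∤! p-prime m (ℕ.<-trans (ℕ.n<1+n m) m<p) p∣m!

prime∣C : ∀ {p k} → Prime p → 0 < k → k < p → p ∣ p C k
prime∣C {p@(suc m)} {k} p-prime 0<k k<p
  with euclidsLemma (p C k) (k ! ℕ.* (p ∸ k) !) p-prime p∣C*k!*[p∸k]!
  where
  k≤p = ℕ.<⇒≤ k<p
  instance _ = ℕ._!*_!≢0 k (p ∸ k)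
  p!≡C*k!*[p∸k]! : p ! ≡ (p C k) ℕ.* (k ! ℕ.* (p ∸ k) !)
  p!≡C*k!*[p∸k]! = ≡.trans (≡.sym (m/n*n≡m (k![n∸k]!∣n! k≤p)))
    (≡.cong (ℕ._* (k ! ℕ.* (p ∸ k) !)) (≡.sym (nCk≡n!/k![n-k]! k≤p)))
  p∣C*k!*[p∸k]! : p ∣ (p C k) ℕ.* (k ! ℕ.* (p ∸ k) !)
  p∣C*k!*[p∸k]! = ≡.subst (p ∣_) p!≡C*k!*[p∸k]! (divides (m !) (ℕ.*-comm p (m !)))
... | inj₁ p∣C = p∣C
... | inj₂ p∣k!*[p∸k]! with euclidsLemma (k !) ((p ∸ k) !) p-prime p∣k!*[p∸k]!
...   | inj₁ p∣k! = ⊥-elim (prime∤! p-prime k k<p p∣k!)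
...   | inj₂ p∣[p∸k]! = ⊥-elim (prime∤! p-prime (p ∸ k) (ℕ.∸-monoʳ-< 0<k (ℕ.<⇒≤ k<p)) p∣[p∸k]!)

module Frobenius {a ℓ} (S : CommutativeSemiring a ℓ) where
  open CommutativeSemiring S
  open import Algebra.Properties.Semiring.Exp semiring using (_^_; ^-assocʳ; ^-congˡ)
  open import Algebra.Properties.Semiring.Mult semiring using (_×_; ×-assoc-*; ×1-homo-*; ×-congʳ)
  open import Algebra.Properties.Monoid.Sum +-monoid using (sum; sum-init-last; sum-cong-≋; sum-replicate-zero)
  open import Algebra.Properties.Semiring.Binomial semiring using (binomialTerm; theorem)
  open import Data.Vec.Functional using (Vector; init; last)
  open SetoidReasoning setoid

  multiple×≈0 : ∀ {p} → p × 1# ≈ 0# → ∀ m x → p ∣ m → m × x ≈ 0#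
  multiple×≈0 {p} char m x (divides t ≡.refl) = begin
    (t ℕ.* p) × x           ≈⟨ ×-congʳ (t ℕ.* p) (*-identityˡ x) ⟨
    (t ℕ.* p) × (1# * x)    ≈⟨ ×-assoc-* (t ℕ.* p) 1# x ⟨
    ((t ℕ.* p) × 1#) * x    ≈⟨ *-congʳ (×1-homo-* t p) ⟩
    (t × 1#) * (p × 1#) * x ≈⟨ *-congʳ (*-congˡ char) ⟩
    (t × 1#) * 0# * x       ≈⟨ *-congʳ (zeroʳ _) ⟩
    0# * x                  ≈⟨ zeroˡ x ⟩
    0#                      ∎

  +-^-prime : ∀ {p} → Prime p → p × 1# ≈ 0# → ∀ x y → (x + y) ^ p ≈ x ^ p + y ^ p
  +-^-prime {suc m} p-prime char x y = begin
    (x + y) ^ suc m                              ≈⟨ theorem x y (*-comm x y) (suc m) ⟩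
    binomialTerm x y (suc m) Fin.zero + sum t    ≈⟨ +-congʳ (+-identityʳ _) ⟩
    1# * y ^ suc m + sum t                       ≈⟨ +-cong (*-identityˡ _) (sum-init-last t) ⟩
    y ^ suc m + (sum (init t) + last t)          ≈⟨ +-congˡ (+-cong inner-terms≈0 outer-term) ⟩
    y ^ suc m + (0# + x ^ suc m)                 ≈⟨ +-congˡ (+-identityˡ _) ⟩
    y ^ suc m + x ^ suc m                        ≈⟨ +-comm _ _ ⟩
    x ^ suc m + y ^ suc m                        ∎
    where
    t : Vector Carrier (suc m)
    t k = binomialTerm x y (suc m) (Fin.suc k)
    outer-term : last t ≈ x ^ suc m
    outer-term rewrite toℕ-fromℕ m | nCn≡1 (suc m) | ℕ.n∸n≡0 m =
      trans (+-identityʳ _) (*-identityʳ _)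
    inner-terms≈0 : sum (init t) ≈ 0#
    inner-terms≈0 = trans (sum-cong-≋ (λ i → multiple×≈0 char _ _ (prime∣C p-prime (s≤s z≤n)
                      (s≤s (≡.subst (_< m) (≡.sym (toℕ-inject₁ i)) (toℕ<n i))))))
                    (sum-replicate-zero m)

  +-^-primePower : ∀ {p} → Prime p → p × 1# ≈ 0# →
                   ∀ k x y → (x + y) ^ (p ℕ.^ k) ≈ x ^ (p ℕ.^ k) + y ^ (p ℕ.^ k)
  +-^-primePower p-prime char zero    x y = distribʳ 1# x y
  +-^-primePower {p} p-prime char (suc k) x y = begin
    (x + y) ^ (p ℕ.* pᵏ)            ≈⟨ ^-assocʳ (x + y) p pᵏ ⟨
    ((x + y) ^ p) ^ pᵏ              ≈⟨ ^-congˡ pᵏ (+-^-prime p-prime char x y) ⟩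
    (x ^ p + y ^ p) ^ pᵏ            ≈⟨ +-^-primePower p-prime char k (x ^ p) (y ^ p) ⟩
    (x ^ p) ^ pᵏ + (y ^ p) ^ pᵏ     ≈⟨ +-cong (^-assocʳ x p pᵏ) (^-assocʳ y p pᵏ) ⟩
    x ^ (p ℕ.* pᵏ) + y ^ (p ℕ.* pᵏ) ∎
    where pᵏ = p ℕ.^ k

module FiniteCommutativeRing {c ℓ} (K : CommutativeRing c ℓ) {N : ℕ} (card : HasCard K N) where
  open CommutativeRing K
  open import Algebra.Properties.Semiring.Exp semiring using (_^_; ^-congˡ)
  open import Algebra.Properties.Semiring.Mult semiring using (_×_; ×1-homo-*)
  open import Algebra.Properties.Group +-group using (//-rightDividesˡ; //-rightDividesʳ; identityˡ-unique; identityʳ-unique; x∙y⁻¹≈ε⇒x≈y)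
  open import Algebra.Properties.CommutativeMonoid.Sum +-commutativeMonoid
    using (sum; sum-permute; ∑-distrib-+; sum-replicate; sum-cong-≋)
  open import Data.Fin.Permutation using (permutation)
  import Data.Fin.Properties as Fin
  import Data.Vec.Functional as Vector
  open SetoidReasoning setoid

  private
    enum : Fin N → Carrier
    enum = proj₁ card

    enum-injective : ∀ i j → enum i ≈ enum j → i ≡ j
    enum-injective = proj₁ (proj₂ card)

    index : Carrier → Fin N
    index x = proj₁ (proj₂ (proj₂ card) x)

    enum-index : ∀ x → enum (index x) ≈ x
    enum-index x = proj₂ (proj₂ (proj₂ card) x)

  _≟_ : ∀ x y → Dec (x ≈ y)
  x ≟ y with index x Fin.≟ index y
  ... | yes i≡j = yes (trans (sym (enum-index x)) (trans (reflexive (≡.cong enum i≡j)) (enum-index y)))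
  ... | no  i≢j = no (λ x≈y → i≢j (enum-injective _ _ (trans (enum-index x) (trans x≈y (sym (enum-index y))))))

  -- Translation by 1# permutes the elements, so their sum S satisfies S ≈ S + N × 1#.
  size×1≈0 : N × 1# ≈ 0#
  size×1≈0 = identityʳ-unique S (N × 1#) (sym S≈S+N×1)
    where
    S = sum enum
    succ pred : Fin N → Fin N
    succ i = index (enum i + 1#)
    pred i = index (enum i - 1#)
    succ-pred : ∀ i → succ (pred i) ≡ i
    succ-pred i = enum-injective _ _ (begin
      enum (succ (pred i))   ≈⟨ enum-index _ ⟩
      enum (pred i) + 1#     ≈⟨ +-congʳ (enum-index _) ⟩
      (enum i - 1#) + 1#     ≈⟨ //-rightDividesˡ 1# (enum i) ⟩
      enum i                 ∎)
    pred-succ : ∀ i → pred (succ i) ≡ i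
    pred-succ i = enum-injective _ _ (begin
      enum (pred (succ i))   ≈⟨ enum-index _ ⟩
      enum (succ i) - 1#     ≈⟨ +-congʳ (enum-index _) ⟩
      (enum i + 1#) - 1#     ≈⟨ //-rightDividesʳ 1# (enum i) ⟩
      enum i                 ∎)
    S≈S+N×1 : S ≈ S + N × 1#
    S≈S+N×1 = begin
      S                               ≈⟨ sum-permute enum (permutation succ pred succ-pred pred-succ) ⟩
      sum (λ i → enum (succ i))       ≈⟨ sum-cong-≋ (λ i → enum-index (enum i + 1#)) ⟩
      sum (λ i → enum i + 1#)         ≈⟨ ∑-distrib-+ enum (Vector.replicate N 1#) ⟩
      S + sum (Vector.replicate N 1#) ≈⟨ +-congˡ (sum-replicate N) ⟩
      S + N × 1#                      ∎

  module _ (isField : IsField K) where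

    *≈0⇒≈0 : ∀ {x z} → ¬ (x ≈ 0#) → x * z ≈ 0# → z ≈ 0#
    *≈0⇒≈0 {x} {z} x≉0 xz≈0 = begin
      z            ≈⟨ *-identityˡ z ⟨
      1# * z       ≈⟨ *-congʳ (proj₂ x⁻¹) ⟨
      x * y * z    ≈⟨ *-congʳ (*-comm x y) ⟩
      y * x * z    ≈⟨ *-assoc y x z ⟩
      y * (x * z)  ≈⟨ *-congˡ xz≈0 ⟩
      y * 0#       ≈⟨ zeroʳ y ⟩
      0#           ∎
      where
      x⁻¹ = proj₂ isField x x≉0
      y = proj₁ x⁻¹

    ^≈0⇒≈0 : ∀ x m → x ^ m ≈ 0# → x ≈ 0#
    ^≈0⇒≈0 x zero    1≈0   = ⊥-elim (proj₁ isField 1≈0)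
    ^≈0⇒≈0 x (suc m) xᵐ⁺¹≈0 with x ≟ 0#
    ... | yes x≈0 = x≈0
    ... | no  x≉0 = ^≈0⇒≈0 x m (*≈0⇒≈0 x≉0 xᵐ⁺¹≈0)

    module _ {p m : ℕ} (p-prime : Prime p) (N≡pᵐ : N ≡ p ℕ.^ m) where

      characteristic : p × 1# ≈ 0#
      characteristic = ^≈0⇒≈0 (p × 1#) m (begin
        (p × 1#) ^ m     ≈⟨ ×1-homo-^ m ⟨
        (p ℕ.^ m) × 1#   ≡⟨ ≡.cong (_× 1#) N≡pᵐ ⟨
        N × 1#           ≈⟨ size×1≈0 ⟩
        0#               ∎)
        where
        ×1-homo-^ : ∀ j → (p ℕ.^ j) × 1# ≈ (p × 1#) ^ j
        ×1-homo-^ zero    = +-identityʳ 1#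
        ×1-homo-^ (suc j) = trans (×1-homo-* p (p ℕ.^ j)) (*-congˡ (×1-homo-^ j))

      frobenius-injective : ∀ k x y → x ^ (p ℕ.^ k) ≈ y ^ (p ℕ.^ k) → x ≈ y
      frobenius-injective k x y xᵠ≈yᵠ = x∙y⁻¹≈ε⇒x≈y x y (^≈0⇒≈0 (x - y) φ (identityˡ-unique _ _ (begin
        (x - y) ^ φ + y ^ φ  ≈⟨ +-^-primePower p-prime characteristic k (x - y) y ⟨
        ((x - y) + y) ^ φ    ≈⟨ ^-congˡ φ (//-rightDividesˡ y x) ⟩
        x ^ φ                ≈⟨ xᵠ≈yᵠ ⟩
        y ^ φ                ∎)))
        where
        φ = p ℕ.^ k
        open Frobenius commutativeSemiring using (+-^-primePower)

module Polynomial {c ℓ} (K : CommutativeRing c ℓ) where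
  open CommutativeRing K
  open import Relation.Binary using (Setoid; IsEquivalence)
  open import Algebra.Structures using (IsCommutativeMonoid)
  import Algebra.Structures.Biased as Biased
  import Algebra.Properties.CommutativeSemigroup as CommutativeSemigroup

  infixl 6 _⊕_
  infixl 7 _⊗_
  infix 4 _≋_

  _⊕_ : Poly K → Poly K → Poly K
  _⊕_ = _+ₚ_ K

  _⊗_ : Poly K → Poly K → Poly K
  _⊗_ = _*ₚ_ K

  -- A record rather than _≈ₚ_ itself, so that both polynomials can be inferred.
  record _≋_ (X Y : Poly K) : Set ℓ where
    constructor mk≋
    field coeff≈ : ∀ i → coeff K X i ≈ coeff K Y i
  open _≋_ public

  scale : Carrier → Poly K → Poly K
  scale a = map (a *_)

  shift : Poly K → Poly K
  shift X = 0# ∷ X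

  ≋-refl : ∀ {X} → X ≋ X
  ≋-refl = mk≋ λ _ → refl

  ≋-reflexive : ∀ {X Y} → X ≡ Y → X ≋ Y
  ≋-reflexive ≡.refl = ≋-refl

  ≋-sym : ∀ {X Y} → X ≋ Y → Y ≋ X
  ≋-sym X≋Y = mk≋ λ i → sym (coeff≈ X≋Y i)

  ≋-trans : ∀ {X Y Z} → X ≋ Y → Y ≋ Z → X ≋ Z
  ≋-trans X≋Y Y≋Z = mk≋ λ i → trans (coeff≈ X≋Y i) (coeff≈ Y≋Z i)

  ≋-isEquivalence : IsEquivalence _≋_
  ≋-isEquivalence = record { refl = ≋-refl ; sym = ≋-sym ; trans = ≋-trans }

  ≋-setoid : Setoid c ℓ
  ≋-setoid = record { isEquivalence = ≋-isEquivalence }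

  coeff-⊕ : ∀ X Y i → coeff K (X ⊕ Y) i ≈ coeff K X i + coeff K Y i
  coeff-⊕ []      Y       i       = sym (+-identityˡ _)
  coeff-⊕ (a ∷ X) []      i       = sym (+-identityʳ _)
  coeff-⊕ (a ∷ X) (b ∷ Y) zero    = refl
  coeff-⊕ (a ∷ X) (b ∷ Y) (suc i) = coeff-⊕ X Y i

  coeff-scale : ∀ a X i → coeff K (scale a X) i ≈ a * coeff K X i
  coeff-scale a []      i       = sym (zeroʳ a)
  coeff-scale a (b ∷ X) zero    = refl
  coeff-scale a (b ∷ X) (suc i) = coeff-scale a X i

  ⊕-cong : ∀ {X X′ Y Y′} → X ≋ X′ → Y ≋ Y′ → X ⊕ Y ≋ X′ ⊕ Y′
  ⊕-cong {X} {X′} {Y} {Y′} X≋X′ Y≋Y′ = mk≋ λ i → begin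
    coeff K (X ⊕ Y) i             ≈⟨ coeff-⊕ X Y i ⟩
    coeff K X i + coeff K Y i     ≈⟨ +-cong (coeff≈ X≋X′ i) (coeff≈ Y≋Y′ i) ⟩
    coeff K X′ i + coeff K Y′ i   ≈⟨ coeff-⊕ X′ Y′ i ⟨
    coeff K (X′ ⊕ Y′) i           ∎
    where open SetoidReasoning setoid

  ⊕-assoc : ∀ X Y Z → (X ⊕ Y) ⊕ Z ≋ X ⊕ (Y ⊕ Z)
  ⊕-assoc X Y Z = mk≋ λ i → begin
    coeff K ((X ⊕ Y) ⊕ Z) i                      ≈⟨ coeff-⊕ (X ⊕ Y) Z i ⟩
    coeff K (X ⊕ Y) i + coeff K Z i              ≈⟨ +-congʳ (coeff-⊕ X Y i) ⟩
    (coeff K X i + coeff K Y i) + coeff K Z i    ≈⟨ +-assoc _ _ _ ⟩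
    coeff K X i + (coeff K Y i + coeff K Z i)    ≈⟨ +-congˡ (coeff-⊕ Y Z i) ⟨
    coeff K X i + coeff K (Y ⊕ Z) i              ≈⟨ coeff-⊕ X (Y ⊕ Z) i ⟨
    coeff K (X ⊕ (Y ⊕ Z)) i                      ∎
    where open SetoidReasoning setoid

  ⊕-comm : ∀ X Y → X ⊕ Y ≋ Y ⊕ X
  ⊕-comm X Y = mk≋ λ i → begin
    coeff K (X ⊕ Y) i           ≈⟨ coeff-⊕ X Y i ⟩
    coeff K X i + coeff K Y i   ≈⟨ +-comm _ _ ⟩
    coeff K Y i + coeff K X i   ≈⟨ coeff-⊕ Y X i ⟨
    coeff K (Y ⊕ X) i           ∎
    where open SetoidReasoning setoid

  ⊕-identityˡ : ∀ X → [] ⊕ X ≋ X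
  ⊕-identityˡ X = ≋-refl

  ⊕-identityʳ : ∀ X → X ⊕ [] ≋ X
  ⊕-identityʳ X = mk≋ λ i → trans (coeff-⊕ X [] i) (+-identityʳ _)

  ⊕-isCommutativeMonoid : IsCommutativeMonoid _≋_ _⊕_ []
  ⊕-isCommutativeMonoid = record
    { isMonoid = record
      { isSemigroup = record
        { isMagma = record { isEquivalence = ≋-isEquivalence ; ∙-cong = ⊕-cong }
        ; assoc = ⊕-assoc }
      ; identity = ⊕-identityˡ , ⊕-identityʳ }
    ; comm = ⊕-comm }

  ⊕-interchange : ∀ X Y Z W → (X ⊕ Y) ⊕ (Z ⊕ W) ≋ (X ⊕ Z) ⊕ (Y ⊕ W)
  ⊕-interchange = CommutativeSemigroup.interchange
    (CommutativeMonoid.commutativeSemigroup (record { isCommutativeMonoid = ⊕-isCommutativeMonoid }))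

  shift-[] : shift [] ≋ []
  shift-[] = mk≋ λ { zero → refl ; (suc i) → refl }

  shift-cong : ∀ {X Y} → X ≋ Y → shift X ≋ shift Y
  shift-cong X≋Y = mk≋ λ { zero → refl ; (suc i) → coeff≈ X≋Y i }

  shift-⊕ : ∀ X Y → shift (X ⊕ Y) ≋ shift X ⊕ shift Y
  shift-⊕ X Y = mk≋ λ { zero → sym (+-identityʳ 0#) ; (suc i) → refl }

  ∷≋constant⊕shift : ∀ a X → (a ∷ X) ≋ [ a ] ⊕ shift X
  ∷≋constant⊕shift a X = mk≋ λ { zero → sym (+-identityʳ a) ; (suc i) → refl }

  scale-cong : ∀ {a b X Y} → a ≈ b → X ≋ Y → scale a X ≋ scale b Y
  scale-cong {a} {b} {X} {Y} a≈b X≋Y = mk≋ λ i → begin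
    coeff K (scale a X) i   ≈⟨ coeff-scale a X i ⟩
    a * coeff K X i         ≈⟨ *-cong a≈b (coeff≈ X≋Y i) ⟩
    b * coeff K Y i         ≈⟨ coeff-scale b Y i ⟨
    coeff K (scale b Y) i   ∎
    where open SetoidReasoning setoid

  scale-zero : ∀ {a} X → a ≈ 0# → scale a X ≋ []
  scale-zero {a} X a≈0 = mk≋ λ i → begin
    coeff K (scale a X) i   ≈⟨ coeff-scale a X i ⟩
    a * coeff K X i         ≈⟨ *-congʳ a≈0 ⟩
    0# * coeff K X i        ≈⟨ zeroˡ _ ⟩
    0#                      ∎
    where open SetoidReasoning setoid

  scale-⊕ : ∀ a X Y → scale a (X ⊕ Y) ≋ scale a X ⊕ scale a Y
  scale-⊕ a X Y = mk≋ λ i → begin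
    coeff K (scale a (X ⊕ Y)) i                        ≈⟨ coeff-scale a (X ⊕ Y) i ⟩
    a * coeff K (X ⊕ Y) i                              ≈⟨ *-congˡ (coeff-⊕ X Y i) ⟩
    a * (coeff K X i + coeff K Y i)                    ≈⟨ distribˡ _ _ _ ⟩
    a * coeff K X i + a * coeff K Y i                  ≈⟨ +-cong (coeff-scale a X i) (coeff-scale a Y i) ⟨
    coeff K (scale a X) i + coeff K (scale a Y) i      ≈⟨ coeff-⊕ (scale a X) (scale a Y) i ⟨
    coeff K (scale a X ⊕ scale a Y) i                  ∎
    where open SetoidReasoning setoid

  scale-* : ∀ a b X → scale (a * b) X ≋ scale a (scale b X)
  scale-* a b X = mk≋ λ i → begin
    coeff K (scale (a * b) X) i     ≈⟨ coeff-scale (a * b) X i ⟩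
    (a * b) * coeff K X i           ≈⟨ *-assoc _ _ _ ⟩
    a * (b * coeff K X i)           ≈⟨ *-congˡ (coeff-scale b X i) ⟨
    a * coeff K (scale b X) i       ≈⟨ coeff-scale a (scale b X) i ⟨
    coeff K (scale a (scale b X)) i ∎
    where open SetoidReasoning setoid

  scale-shift : ∀ a X → scale a (shift X) ≋ shift (scale a X)
  scale-shift a X = mk≋ λ { zero → zeroʳ a ; (suc i) → refl }

  scale-1# : ∀ X → scale 1# X ≋ X
  scale-1# X = mk≋ λ i → trans (coeff-scale 1# X i) (*-identityˡ _)

  ⊗-congʳ : ∀ X {Y Y′} → Y ≋ Y′ → X ⊗ Y ≋ X ⊗ Y′
  ⊗-congʳ []      Y≋Y′ = ≋-refl
  ⊗-congʳ (a ∷ X) Y≋Y′ = ⊕-cong (scale-cong refl Y≋Y′) (shift-cong (⊗-congʳ X Y≋Y′))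

  ⊗-zeroʳ : ∀ X → X ⊗ [] ≋ []
  ⊗-zeroʳ []      = ≋-refl
  ⊗-zeroʳ (a ∷ X) = ≋-trans (shift-cong (⊗-zeroʳ X)) shift-[]

  ⊗-shift : ∀ X Y → X ⊗ shift Y ≋ shift (X ⊗ Y)
  ⊗-shift []      Y = ≋-sym shift-[]
  ⊗-shift (a ∷ X) Y = begin
      scale a (shift Y) ⊕ shift (X ⊗ shift Y)     ≈⟨ ⊕-cong (scale-shift a Y) (shift-cong (⊗-shift X Y)) ⟩
      shift (scale a Y) ⊕ shift (shift (X ⊗ Y))   ≈⟨ shift-⊕ (scale a Y) (shift (X ⊗ Y)) ⟨
      shift (scale a Y ⊕ shift (X ⊗ Y))           ∎
    where open SetoidReasoning ≋-setoid

  ⊗-constant : ∀ X a → X ⊗ [ a ] ≋ scale a X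
  ⊗-constant []      a = ≋-refl
  ⊗-constant (b ∷ X) a = mk≋ λ { zero → trans (+-identityʳ _) (*-comm b a) ; (suc i) → coeff≈ (⊗-constant X a) i }

  ⊗-distribˡ : ∀ X Y Z → X ⊗ (Y ⊕ Z) ≋ X ⊗ Y ⊕ X ⊗ Z
  ⊗-distribˡ []      Y Z = ≋-refl
  ⊗-distribˡ (a ∷ X) Y Z = begin
      scale a (Y ⊕ Z) ⊕ shift (X ⊗ (Y ⊕ Z))
        ≈⟨ ⊕-cong (scale-⊕ a Y Z) (≋-trans (shift-cong (⊗-distribˡ X Y Z)) (shift-⊕ (X ⊗ Y) (X ⊗ Z))) ⟩
      (scale a Y ⊕ scale a Z) ⊕ (shift (X ⊗ Y) ⊕ shift (X ⊗ Z))
        ≈⟨ ⊕-interchange (scale a Y) (scale a Z) (shift (X ⊗ Y)) (shift (X ⊗ Z)) ⟩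
      (scale a Y ⊕ shift (X ⊗ Y)) ⊕ (scale a Z ⊕ shift (X ⊗ Z))
        ∎
    where open SetoidReasoning ≋-setoid

  ⊗-comm : ∀ X Y → X ⊗ Y ≋ Y ⊗ X
  ⊗-comm []      Y = ≋-sym (⊗-zeroʳ Y)
  ⊗-comm (a ∷ X) Y = begin
      scale a Y ⊕ shift (X ⊗ Y)   ≈⟨ ⊕-cong (≋-sym (⊗-constant Y a)) (shift-cong (⊗-comm X Y)) ⟩
      Y ⊗ [ a ] ⊕ shift (Y ⊗ X)   ≈⟨ ⊕-cong ≋-refl (⊗-shift Y X) ⟨
      Y ⊗ [ a ] ⊕ Y ⊗ shift X     ≈⟨ ⊗-distribˡ Y [ a ] (shift X) ⟨
      Y ⊗ ([ a ] ⊕ shift X)       ≈⟨ ⊗-congʳ Y (∷≋constant⊕shift a X) ⟨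
      Y ⊗ (a ∷ X)                 ∎
    where open SetoidReasoning ≋-setoid

  ⊗-cong : ∀ {X X′ Y Y′} → X ≋ X′ → Y ≋ Y′ → X ⊗ Y ≋ X′ ⊗ Y′
  ⊗-cong {X} {X′} {Y} {Y′} X≋X′ Y≋Y′ =
    ≋-trans (⊗-comm X Y) (≋-trans (⊗-congʳ Y X≋X′) (≋-trans (⊗-comm Y X′) (⊗-congʳ X′ Y≋Y′)))

  ⊗-distribʳ : ∀ X Y Z → (Y ⊕ Z) ⊗ X ≋ Y ⊗ X ⊕ Z ⊗ X
  ⊗-distribʳ X Y Z = ≋-trans (⊗-comm (Y ⊕ Z) X)
    (≋-trans (⊗-distribˡ X Y Z) (⊕-cong (⊗-comm X Y) (⊗-comm X Z)))

  scale-⊗ : ∀ a X Y → scale a X ⊗ Y ≋ scale a (X ⊗ Y)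
  scale-⊗ a []      Y = ≋-refl
  scale-⊗ a (b ∷ X) Y = begin
      scale (a * b) Y ⊕ shift (scale a X ⊗ Y)         ≈⟨ ⊕-cong (scale-* a b Y) (shift-cong (scale-⊗ a X Y)) ⟩
      scale a (scale b Y) ⊕ shift (scale a (X ⊗ Y))   ≈⟨ ⊕-cong ≋-refl (scale-shift a (X ⊗ Y)) ⟨
      scale a (scale b Y) ⊕ scale a (shift (X ⊗ Y))   ≈⟨ scale-⊕ a (scale b Y) (shift (X ⊗ Y)) ⟨
      scale a (scale b Y ⊕ shift (X ⊗ Y))             ∎
    where open SetoidReasoning ≋-setoid

  shift-⊗ : ∀ X Y → shift X ⊗ Y ≋ shift (X ⊗ Y)
  shift-⊗ X Y = ⊕-cong (scale-zero Y refl) ≋-refl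

  ⊗-assoc : ∀ X Y Z → (X ⊗ Y) ⊗ Z ≋ X ⊗ (Y ⊗ Z)
  ⊗-assoc []      Y Z = ≋-refl
  ⊗-assoc (a ∷ X) Y Z = begin
      (scale a Y ⊕ shift (X ⊗ Y)) ⊗ Z        ≈⟨ ⊗-distribʳ Z (scale a Y) (shift (X ⊗ Y)) ⟩
      scale a Y ⊗ Z ⊕ shift (X ⊗ Y) ⊗ Z      ≈⟨ ⊕-cong (scale-⊗ a Y Z)
                                                 (≋-trans (shift-⊗ (X ⊗ Y) Z) (shift-cong (⊗-assoc X Y Z))) ⟩
      scale a (Y ⊗ Z) ⊕ shift (X ⊗ (Y ⊗ Z))  ∎
    where open SetoidReasoning ≋-setoid

  ⊗-identityˡ : ∀ X → [ 1# ] ⊗ X ≋ X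
  ⊗-identityˡ X = ≋-trans (⊕-cong (scale-1# X) shift-[]) (⊕-identityʳ X)

  ⊗-identityʳ : ∀ X → X ⊗ [ 1# ] ≋ X
  ⊗-identityʳ X = ≋-trans (⊗-comm X [ 1# ]) (⊗-identityˡ X)

  polynomialSemiring : CommutativeSemiring c ℓ
  polynomialSemiring = record
    { Carrier = Poly K ; _≈_ = _≋_ ; _+_ = _⊕_ ; _*_ = _⊗_ ; 0# = [] ; 1# = [ 1# ]
    ; isCommutativeSemiring = Biased.isCommutativeSemiringʳ (record
      { +-isCommutativeMonoid = ⊕-isCommutativeMonoid
      ; *-isCommutativeMonoid = record
        { isMonoid = record
          { isSemigroup = record
            { isMagma = record { isEquivalence = ≋-isEquivalence ; ∙-cong = ⊗-cong }
            ; assoc = ⊗-assoc }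
          ; identity = ⊗-identityˡ , ⊗-identityʳ }
        ; comm = ⊗-comm }
      ; distribˡ = ⊗-distribˡ
      ; zeroʳ = ⊗-zeroʳ })
    }

  shiftⁿ : ℕ → Poly K → Poly K
  shiftⁿ i X = replicate i 0# ++ X

  shiftⁿ-cong : ∀ i {X Y} → X ≋ Y → shiftⁿ i X ≋ shiftⁿ i Y
  shiftⁿ-cong zero    X≋Y = X≋Y
  shiftⁿ-cong (suc i) X≋Y = shift-cong (shiftⁿ-cong i X≋Y)

  shiftⁿ-[] : ∀ i → shiftⁿ i [] ≋ []
  shiftⁿ-[] zero    = ≋-refl
  shiftⁿ-[] (suc i) = ≋-trans (shift-cong (shiftⁿ-[] i)) shift-[]

  shiftⁿ-⊕ : ∀ i X Y → shiftⁿ i (X ⊕ Y) ≋ shiftⁿ i X ⊕ shiftⁿ i Y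
  shiftⁿ-⊕ zero    X Y = ≋-refl
  shiftⁿ-⊕ (suc i) X Y = ≋-trans (shift-cong (shiftⁿ-⊕ i X Y)) (shift-⊕ (shiftⁿ i X) (shiftⁿ i Y))

  shiftⁿ-⊗ : ∀ i X Y → shiftⁿ i X ⊗ Y ≋ shiftⁿ i (X ⊗ Y)
  shiftⁿ-⊗ zero    X Y = ≋-refl
  shiftⁿ-⊗ (suc i) X Y = ≋-trans (shift-⊗ (shiftⁿ i X) Y) (shift-cong (shiftⁿ-⊗ i X Y))

  shiftⁿ-+ : ∀ i j X → shiftⁿ i (shiftⁿ j X) ≡ shiftⁿ (i ℕ.+ j) X
  shiftⁿ-+ zero    j X = ≡.refl
  shiftⁿ-+ (suc i) j X = ≡.cong (0# ∷_) (shiftⁿ-+ i j X)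

  shiftⁿ-∷ : ∀ i a X → shiftⁿ i (a ∷ X) ≋ mon K a i ⊕ shiftⁿ (suc i) X
  shiftⁿ-∷ i a X = ≋-trans (shiftⁿ-cong i (∷≋constant⊕shift a X))
    (≋-trans (shiftⁿ-⊕ i [ a ] (shift X))
    (⊕-cong ≋-refl (≋-reflexive (≡.trans (shiftⁿ-+ i 1 X) (≡.cong (λ j → shiftⁿ j X) (ℕ.+-comm i 1))))))

  coeff-mon : ∀ a e → coeff K (mon K a e) e ≡ a
  coeff-mon a zero    = ≡.refl
  coeff-mon a (suc e) = coeff-mon a e

  coeff-mon-≢ : ∀ a e d → d ≢ e → coeff K (mon K a e) d ≈ 0#
  coeff-mon-≢ a zero    zero    d≢e = ⊥-elim (d≢e ≡.refl)
  coeff-mon-≢ a zero    (suc d) d≢e = refl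
  coeff-mon-≢ a (suc e) zero    d≢e = refl
  coeff-mon-≢ a (suc e) (suc d) d≢e = coeff-mon-≢ a e d (d≢e ∘ ≡.cong suc)

  mon-cong : ∀ {a b} e → a ≈ b → mon K a e ≋ mon K b e
  mon-cong e a≈b = shiftⁿ-cong e (mk≋ λ { zero → a≈b ; (suc i) → refl })

  mon-zero : ∀ {a} e → a ≈ 0# → mon K a e ≋ []
  mon-zero e a≈0 = ≋-trans (mon-cong e a≈0) (≋-trans (shiftⁿ-cong e shift-[]) (shiftⁿ-[] e))

  mon-+ : ∀ a b e → mon K (a + b) e ≋ mon K a e ⊕ mon K b e
  mon-+ a b e = shiftⁿ-⊕ e [ a ] [ b ]

  mon-⊗ : ∀ a b i j → mon K a i ⊗ mon K b j ≋ mon K (a * b) (i ℕ.+ j)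
  mon-⊗ a b i j = begin
      shiftⁿ i [ a ] ⊗ mon K b j         ≈⟨ shiftⁿ-⊗ i [ a ] (mon K b j) ⟩
      shiftⁿ i ([ a ] ⊗ mon K b j)       ≈⟨ shiftⁿ-cong i (⊗-comm [ a ] (mon K b j)) ⟩
      shiftⁿ i (mon K b j ⊗ [ a ])       ≈⟨ shiftⁿ-cong i (shiftⁿ-⊗ j [ b ] [ a ]) ⟩
      shiftⁿ i (shiftⁿ j ([ b ] ⊗ [ a ])) ≈⟨ shiftⁿ-cong i (shiftⁿ-cong j [b]⊗[a]≋[a*b]) ⟩
      shiftⁿ i (shiftⁿ j [ a * b ])     ≡⟨ shiftⁿ-+ i j [ a * b ] ⟩
      mon K (a * b) (i ℕ.+ j)           ∎
    where
    open SetoidReasoning ≋-setoid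
    [b]⊗[a]≋[a*b] : [ b ] ⊗ [ a ] ≋ [ a * b ]
    [b]⊗[a]≋[a*b] = mk≋ λ { zero → trans (+-identityʳ _) (*-comm b a) ; (suc i) → refl }

  ^ₚ-cong : ∀ {X Y} m → X ≋ Y → _^ₚ_ K X m ≋ _^ₚ_ K Y m
  ^ₚ-cong zero    X≋Y = ≋-refl
  ^ₚ-cong (suc m) X≋Y = ⊗-cong X≋Y (^ₚ-cong m X≋Y)

  mon-^ₚ : ∀ a e m → _^ₚ_ K (mon K a e) m ≋ mon K (pow K a m) (e ℕ.* m)
  mon-^ₚ a e zero    = ≋-reflexive (≡.cong (mon K 1#) (≡.sym (ℕ.*-zeroʳ e)))
  mon-^ₚ a e (suc m) = ≋-trans (⊗-congʳ (mon K a e) (mon-^ₚ a e m))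
    (≋-trans (mon-⊗ a (pow K a m) e (e ℕ.* m)) (≋-reflexive (≡.cong (mon K _) (≡.sym (ℕ.*-suc e m)))))


  mon-injective : ∀ {a b} d e → ¬ (a ≈ 0#) → mon K a d ≋ mon K b e → d ≡ e Product.× a ≈ b
  mon-injective {a} {b} d e a≉0 eq with d ℕ.≟ e
  ... | no  d≢e    = ⊥-elim (a≉0 (trans (reflexive (≡.sym (coeff-mon a d))) (trans (coeff≈ eq d) (coeff-mon-≢ b e d d≢e))))
  ... | yes ≡.refl = ≡.refl , trans (reflexive (≡.sym (coeff-mon a d))) (trans (coeff≈ eq d) (reflexive (coeff-mon b d)))

  coeff-map : ∀ f → f 0# ≈ 0# → ∀ X i → coeff K (map f X) i ≈ f (coeff K X i)
  coeff-map f f0≈0 []      i       = sym f0≈0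
  coeff-map f f0≈0 (a ∷ X) zero    = refl
  coeff-map f f0≈0 (a ∷ X) (suc i) = coeff-map f f0≈0 X i

  coeff-≉0⇒<length : ∀ X i → ¬ (coeff K X i ≈ 0#) → i < length X
  coeff-≉0⇒<length []      i       ≉0 = ⊥-elim (≉0 refl)
  coeff-≉0⇒<length (a ∷ X) zero    ≉0 = s≤s z≤n
  coeff-≉0⇒<length (a ∷ X) (suc i) ≉0 = s≤s (coeff-≉0⇒<length X i ≉0)

  module _ where
    open CommutativeSemiring polynomialSemiring using () renaming (semiring to polynomialSemiring′)
    open import Algebra.Properties.Semiring.Exp polynomialSemiring′ using () renaming (_^_ to _^′_)
    open import Algebra.Properties.Semiring.Mult polynomialSemiring′ using () renaming (_×_ to _×′_)
    open import Algebra.Properties.Semiring.Mult semiring using (_×_)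

    ^ₚ≡^ : ∀ X m → _^ₚ_ K X m ≡ X ^′ m
    ^ₚ≡^ X zero    = ≡.refl
    ^ₚ≡^ X (suc m) = ≡.cong (X ⊗_) (^ₚ≡^ X m)

    ×-constant : ∀ n a → n ×′ [ a ] ≋ [ n × a ]
    ×-constant zero    a = mk≋ λ { zero → refl ; (suc i) → refl }
    ×-constant (suc n) a = ⊕-cong ≋-refl (×-constant n a)

    ⊕-^ₚ-primePower : ∀ {p} → Prime p → p × 1# ≈ 0# → ∀ k X Y →
      _^ₚ_ K (X ⊕ Y) (p ℕ.^ k) ≋ _^ₚ_ K X (p ℕ.^ k) ⊕ _^ₚ_ K Y (p ℕ.^ k)
    ⊕-^ₚ-primePower {p} p-prime char k X Y = begin
      _^ₚ_ K (X ⊕ Y) φ                ≡⟨ ^ₚ≡^ (X ⊕ Y) φ ⟩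
      (X ⊕ Y) ^′ φ                    ≈⟨ +-^-primePower p-prime polynomial-char k X Y ⟩
      X ^′ φ ⊕ Y ^′ φ                 ≡⟨ ≡.cong₂ _⊕_ (^ₚ≡^ X φ) (^ₚ≡^ Y φ) ⟨
      _^ₚ_ K X φ ⊕ _^ₚ_ K Y φ         ∎
      where
      open SetoidReasoning ≋-setoid
      open Frobenius polynomialSemiring using (+-^-primePower)
      φ = p ℕ.^ k
      polynomial-char : p ×′ [ 1# ] ≋ []
      polynomial-char = ≋-trans (×-constant p 1#) (mk≋ λ { zero → char ; (suc i) → refl })

module _ where
  open import Data.Nat using (_+_; _*_; _%_; pred; NonZero)
  open import Data.Nat.DivMod using (%-distribˡ-+; %-distribˡ-*; [m+n]%n≡m%n)
  open ≡.≡-Reasoning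

  %-+-congˡ : ∀ w x y M .{{_ : NonZero M}} → x % M ≡ y % M → (w + x) % M ≡ (w + y) % M
  %-+-congˡ w x y M x≡y = begin
    (w + x) % M                ≡⟨ %-distribˡ-+ w x M ⟩
    ((w % M) + (x % M)) % M    ≡⟨ ≡.cong (λ z → ((w % M) + z) % M) x≡y ⟩
    ((w % M) + (y % M)) % M    ≡⟨ %-distribˡ-+ w y M ⟨
    (w + y) % M                ∎

  %-*-congʳ : ∀ z x y M .{{_ : NonZero M}} → x % M ≡ y % M → (x * z) % M ≡ (y * z) % M
  %-*-congʳ z x y M x≡y = begin
    (x * z) % M                ≡⟨ %-distribˡ-* x z M ⟩
    ((x % M) * (z % M)) % M    ≡⟨ ≡.cong (λ w → (w * (z % M)) % M) x≡y ⟩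
    ((y % M) * (z % M)) % M    ≡⟨ %-distribˡ-* y z M ⟨
    (y * z) % M                ∎

  %-suc-cancel : ∀ x y M .{{_ : NonZero M}} → suc x % M ≡ suc y % M → x % M ≡ y % M
  %-suc-cancel x y M 1+x≡1+y = begin
    x % M                ≡⟨ [m+n]%n≡m%n x M ⟨
    (x + M) % M          ≡⟨ ≡.cong (_% M) (+M≡pred[M]+suc x) ⟩
    (pred M + suc x) % M ≡⟨ %-+-congˡ (pred M) (suc x) (suc y) M 1+x≡1+y ⟩
    (pred M + suc y) % M ≡⟨ ≡.cong (_% M) (+M≡pred[M]+suc y) ⟨
    (y + M) % M          ≡⟨ [m+n]%n≡m%n y M ⟩
    y % M                ∎
    where
    +M≡pred[M]+suc : ∀ z → z + M ≡ pred M + suc z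
    +M≡pred[M]+suc z = begin
      z + M             ≡⟨ ℕ.+-comm z M ⟩
      M + z             ≡⟨ ≡.cong (_+ z) (ℕ.suc-pred M) ⟨
      suc (pred M) + z  ≡⟨ ℕ.+-suc (pred M) z ⟨
      pred M + suc z    ∎

module ExponentReduction (N : ℕ) (1<N : 1 < N) where
  open import Data.Nat using (_+_; _*_; _%_; _<ᵇ_)
  open import Data.Nat.DivMod using (m<n⇒m%n≡m; [m+n]%n≡m%n; [m+kn]%n≡m%n; m%n%n≡m%n; m%n<n)
  open import Data.Bool using (true; false; if_then_else_; T)
  open ≡.≡-Reasoning

  M : ℕ
  M = N ∸ 1

  instance
    M-nonZero : ℕ.NonZero M
    M-nonZero = ℕ.>-nonZero (ℕ.m<n⇒0<n∸m 1<N)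

  N≡1+M : N ≡ suc M
  N≡1+M = ≡.sym (ℕ.m+[n∸m]≡n (ℕ.<⇒≤ 1<N))

  -- x^j ≡ x^(reduce j) modulo x^N - x; for j ≥ 1, reduce j is the representative of j mod M in [1, M].
  reduce : ℕ → ℕ
  reduce zero    = zero
  reduce (suc j) = suc (j % M)

  reduce-< : ∀ j → reduce j < N
  reduce-< zero    = ℕ.<-≤-trans (s≤s z≤n) 1<N
  reduce-< (suc j) = ≡.subst (suc (j % M) <_) (≡.sym N≡1+M) (s≤s (m%n<n j M))

  reduce-fixes : ∀ j → j < N → reduce j ≡ j
  reduce-fixes zero    _   = ≡.refl
  reduce-fixes (suc j) j<N = ≡.cong suc (m<n⇒m%n≡m (ℕ.≤-pred (≡.subst (suc j <_) N≡1+M j<N)))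

  reduce-+M : ∀ j → reduce (suc j + M) ≡ reduce (suc j)
  reduce-+M j = ≡.cong suc ([m+n]%n≡m%n j M)

  reduce-∸M : ∀ j → N ≤ j → reduce (j ∸ M) ≡ reduce j
  reduce-∸M j N≤j = begin
    reduce (j ∸ M)              ≡⟨ ≡.cong reduce j∸M≡1+j′ ⟩
    reduce (suc j′)             ≡⟨ reduce-+M j′ ⟨
    reduce (suc j′ + M)         ≡⟨ ≡.cong reduce j′+N≡j ⟩
    reduce j                    ∎
    where
    j′ = j ∸ N
    j′+N≡j : suc j′ + M ≡ j
    j′+N≡j = ≡.trans (≡.cong (_+ M) (ℕ.+-comm 1 j′))
               (≡.trans (ℕ.+-assoc j′ 1 M) (≡.trans (≡.cong (j′ +_) (≡.sym N≡1+M)) (ℕ.m∸n+n≡m N≤j)))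
    j∸M≡1+j′ : j ∸ M ≡ suc j′
    j∸M≡1+j′ = ≡.trans (≡.cong (_∸ M) (≡.sym j′+N≡j)) (ℕ.m+n∸n≡m (suc j′) M)

  private
    -- The helper of redExp is local to its where-block. The meta go is solved by the
    -- pattern-unification problem that solve-go poses after abstracting suc f ∸ M and suc f;
    -- go also takes redExp's own argument, which it ignores.
    redExp-unfolding : ∀ {c ℓ} (K : CommutativeRing c ℓ) → Σ (ℕ → ℕ → ℕ → ℕ) λ go →
        (∀ i → redExp K N i ≡ go i i i)
      Product.× (∀ i j → go i zero j ≡ j)
      Product.× (∀ i f j → go i (suc f) j ≡ (if j <ᵇ N then j else go i f (j ∸ M)))
    redExp-unfolding K = go , (λ i → ≡.refl) , (λ i j → ≡.refl) , (λ i f j → ≡.refl)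
      where
      go : ℕ → ℕ → ℕ → ℕ
      go = _
      solve-go : ∀ f → redExp K N (suc f) ≡ (if suc f <ᵇ N then suc f else go (suc f) f (suc f ∸ M))
      solve-go f with suc f ∸ M
      ... | w with suc f
      ... | v = ≡.refl

  redExp≡reduce : ∀ {c ℓ} (K : CommutativeRing c ℓ) i → redExp K N i ≡ reduce i
  redExp≡reduce K i = ≡.trans (unfold i) (go≡reduce i i ℕ.≤-refl)
    where
    go = proj₁ (redExp-unfolding K)
    unfold = proj₁ (proj₂ (redExp-unfolding K))
    go-zero = proj₁ (proj₂ (proj₂ (redExp-unfolding K)))
    go-suc = proj₂ (proj₂ (proj₂ (redExp-unfolding K)))
    go≡reduce : ∀ f j → j ≤ f → go i f j ≡ reduce j
    go≡reduce zero    zero    _   = go-zero i zero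
    go≡reduce (suc f) j       j≤f rewrite go-suc i f j with j <ᵇ N in j<ᵇN
    ... | true  = ≡.sym (reduce-fixes j (ℕ.<ᵇ⇒< j N (≡.subst T (≡.sym j<ᵇN) _)))
    ... | false = ≡.trans (go≡reduce f (j ∸ M) j∸M≤f) (reduce-∸M j N≤j)
      where
      N≤j : N ≤ j
      N≤j = ℕ.≮⇒≥ (λ j<N → ≡.subst T j<ᵇN (ℕ.<⇒<ᵇ j<N))
      j∸M≤f : j ∸ M ≤ f
      j∸M≤f = ℕ.≤-trans (ℕ.∸-monoˡ-≤ M j≤f) (ℕ.∸-monoʳ-≤ (suc f) (ℕ.m<n⇒0<n∸m 1<N))

  reduce[reduce[e]*q]≡reduce[e*q] : ∀ e q → reduce (reduce e * q) ≡ reduce (e * q)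
  reduce[reduce[e]*q]≡reduce[e*q] zero     q        = ≡.refl
  reduce[reduce[e]*q]≡reduce[e*q] (suc e) zero     =
    ≡.cong reduce (≡.trans (ℕ.*-zeroʳ (suc (e % M))) (≡.sym (ℕ.*-zeroʳ (suc e))))
  reduce[reduce[e]*q]≡reduce[e*q] (suc e) (suc q′) =
    ≡.cong suc (%-+-congˡ q′ _ _ M (%-*-congʳ (suc q′) (e % M) e M (m%n%n≡m%n e M)))

  private
    *N%M≡%M : ∀ x → (x * N) % M ≡ x % M
    *N%M≡%M x = ≡.trans (≡.cong (λ n → (x * n) % M) N≡1+M)
                  (≡.trans (≡.cong (_% M) (ℕ.*-suc x M)) ([m+kn]%n≡m%n x x M))

  reduce-*-injective : ∀ {q Q a b} → q * Q ≡ N → a < N → b < N → reduce (a * q) ≡ reduce (b * q) → a ≡ b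
  reduce-*-injective {zero} qQ≡N _ _ _ = ⊥-elim (ℕ.<⇒≢ (ℕ.<-trans (s≤s z≤n) 1<N) qQ≡N)
  reduce-*-injective {suc q′} {Q} {zero}  {zero}  _ _ _ _  = ≡.refl
  reduce-*-injective {suc q′} {Q} {zero}  {suc b} _ _ _ ()
  reduce-*-injective {suc q′} {Q} {suc a} {zero}  _ _ _ ()
  reduce-*-injective {suc q′} {Q} {suc a} {suc b} qQ≡N 1+a<N 1+b<N eq = ≡.cong suc (begin
    a      ≡⟨ m<n⇒m%n≡m (<M 1+a<N) ⟨
    a % M  ≡⟨ %-suc-cancel a b M [1+a]%M≡[1+b]%M ⟩
    b % M  ≡⟨ m<n⇒m%n≡m (<M 1+b<N) ⟩
    b      ∎)
    where
    q = suc q′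
    <M : ∀ {x} → suc x < N → x < M
    <M {x} 1+x<N = ℕ.≤-pred (≡.subst (suc x <_) N≡1+M 1+x<N)
    [1+a]q≡[1+b]q : (suc a * q) % M ≡ (suc b * q) % M
    [1+a]q≡[1+b]q = %-+-congˡ 1 _ _ M (ℕ.suc-injective eq)
    -- q Q = N ≡ 1 (mod M): multiplying by Q undoes multiplying by q.
    [1+a]%M≡[1+b]%M : suc a % M ≡ suc b % M
    [1+a]%M≡[1+b]%M = begin
      suc a % M            ≡⟨ *N%M≡%M (suc a) ⟨
      (suc a * N) % M      ≡⟨ ≡.cong (λ n → (suc a * n) % M) qQ≡N ⟨
      (suc a * (q * Q)) % M ≡⟨ ≡.cong (_% M) (ℕ.*-assoc (suc a) q Q) ⟨
      (suc a * q * Q) % M  ≡⟨ %-*-congʳ Q (suc a * q) (suc b * q) M [1+a]q≡[1+b]q ⟩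
      (suc b * q * Q) % M  ≡⟨ ≡.cong (_% M) (ℕ.*-assoc (suc b) q Q) ⟩
      (suc b * (q * Q)) % M ≡⟨ ≡.cong (λ n → (suc b * n) % M) qQ≡N ⟩
      (suc b * N) % M      ≡⟨ *N%M≡%M (suc b) ⟩
      suc b % M            ∎

  module _ {q Q : ℕ} (qQ≡N : q * Q ≡ N) where

    reduce[[k+Q]*q]≡k*q+1 : ∀ k → k * q + 1 < N → reduce ((k + Q) * q) ≡ k * q + 1
    reduce[[k+Q]*q]≡k*q+1 k kq+1<N = begin
      reduce ((k + Q) * q)      ≡⟨ ≡.cong reduce [k+Q]q≡1+kq+M ⟩
      reduce (suc (k * q) + M)  ≡⟨ reduce-+M (k * q) ⟩
      reduce (suc (k * q))      ≡⟨ reduce-fixes (suc (k * q)) (≡.subst (_< N) (ℕ.+-comm (k * q) 1) kq+1<N) ⟩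
      suc (k * q)               ≡⟨ ℕ.+-comm 1 (k * q) ⟩
      k * q + 1                 ∎
      where
      [k+Q]q≡1+kq+M : (k + Q) * q ≡ suc (k * q) + M
      [k+Q]q≡1+kq+M = begin
        (k + Q) * q     ≡⟨ ℕ.*-distribʳ-+ q k Q ⟩
        k * q + Q * q   ≡⟨ ≡.cong (k * q +_) (≡.trans (ℕ.*-comm Q q) qQ≡N) ⟩
        k * q + N       ≡⟨ ≡.cong (k * q +_) N≡1+M ⟩
        k * q + suc M   ≡⟨ ℕ.+-suc (k * q) M ⟩
        suc (k * q) + M ∎

    k*q+1<N⇒k+Q<N : 1 < q → ∀ k → k * q + 1 < N → k + Q < N
    k*q+1<N⇒k+Q<N 1<q k kq+1<N = ℕ.<-≤-trans (ℕ.+-monoˡ-< Q k<Q) Q+Q≤N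
      where
      Q+Q≤N : Q + Q ≤ N
      Q+Q≤N = ℕ.≤-trans (ℕ.≤-reflexive (≡.cong (Q +_) (≡.sym (ℕ.+-identityʳ Q))))
                (ℕ.≤-trans (ℕ.*-monoˡ-≤ Q 1<q) (ℕ.≤-reflexive qQ≡N))
      kq<Qq : k * q < Q * q
      kq<Qq = ℕ.<-trans (ℕ.m<m+n (k * q) (s≤s z≤n)) (≡.subst (k * q + 1 <_) (≡.trans (≡.sym qQ≡N) (ℕ.*-comm q Q)) kq+1<N)
      k<Q : k < Q
      k<Q = ℕ.*-cancelʳ-< q k Q kq<Qq

module Reindexing {c ℓ} (K : CommutativeRing c ℓ) where
  open CommutativeRing K hiding (zero)
  open Polynomial K

  reindex : (ℕ → ℕ) → ℕ → Poly K → Poly K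
  reindex r i []      = []
  reindex r i (a ∷ X) = mon K a (r i) ⊕ reindex r (suc i) X

  modX≡reindex : ∀ N X → modX K N X ≡ reindex (redExp K N) 0 X
  modX≡reindex N = go≡reindex 0
    where
    -- As in redExp≡reduce: abstracting 0 lets unification recover the helper of modX.
    go : ℕ → Poly K → Poly K
    go = _
    solve-go : ∀ X → modX K N X ≡ go 0 X
    solve-go with 0
    ... | w = λ X → ≡.refl
    go≡reindex : ∀ i X → go i X ≡ reindex (redExp K N) i X
    go≡reindex i []      = ≡.refl
    go≡reindex i (a ∷ X) = ≡.cong (mon K a (redExp K N i) ⊕_) (go≡reindex (suc i) X)

  reindex-≋[] : ∀ r i X → X ≋ [] → reindex r i X ≋ []
  reindex-≋[] r i []      X≋[] = ≋-refl
  reindex-≋[] r i (a ∷ X) X≋[] =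
    ⊕-cong (mon-zero (r i) (coeff≈ X≋[] zero)) (reindex-≋[] r (suc i) X (mk≋ λ j → coeff≈ X≋[] (suc j)))

  reindex-cong : ∀ r i X Y → X ≋ Y → reindex r i X ≋ reindex r i Y
  reindex-cong r i []      Y       X≋Y = ≋-sym (reindex-≋[] r i Y (≋-sym X≋Y))
  reindex-cong r i (a ∷ X) []      X≋Y = reindex-≋[] r i (a ∷ X) X≋Y
  reindex-cong r i (a ∷ X) (b ∷ Y) X≋Y =
    ⊕-cong (mon-cong (r i) (coeff≈ X≋Y zero)) (reindex-cong r (suc i) X Y (mk≋ λ j → coeff≈ X≋Y (suc j)))

  reindex-⊕ : ∀ r i X Y → reindex r i (X ⊕ Y) ≋ reindex r i X ⊕ reindex r i Y
  reindex-⊕ r i []      Y       = ≋-refl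
  reindex-⊕ r i (a ∷ X) []      = ≋-sym (⊕-identityʳ _)
  reindex-⊕ r i (a ∷ X) (b ∷ Y) = begin
      mon K (a + b) (r i) ⊕ reindex r (suc i) (X ⊕ Y)
        ≈⟨ ⊕-cong (mon-+ a b (r i)) (reindex-⊕ r (suc i) X Y) ⟩
      (mon K a (r i) ⊕ mon K b (r i)) ⊕ (reindex r (suc i) X ⊕ reindex r (suc i) Y)
        ≈⟨ ⊕-interchange (mon K a (r i)) (mon K b (r i)) (reindex r (suc i) X) (reindex r (suc i) Y) ⟩
      (mon K a (r i) ⊕ reindex r (suc i) X) ⊕ (mon K b (r i) ⊕ reindex r (suc i) Y)
        ∎
    where open SetoidReasoning ≋-setoid

  reindex-shiftⁿ : ∀ r e i X → reindex r i (shiftⁿ e X) ≋ reindex r (e ℕ.+ i) X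
  reindex-shiftⁿ r zero    i X = ≋-refl
  reindex-shiftⁿ r (suc e) i X = ≋-trans (⊕-cong (mon-zero (r i) refl) (reindex-shiftⁿ r e (suc i) X))
    (≋-reflexive (≡.cong (λ k → reindex r k X) (ℕ.+-suc e i)))

  reindex-mon : ∀ r a e → reindex r 0 (mon K a e) ≋ mon K a (r e)
  reindex-mon r a e = ≋-trans (reindex-shiftⁿ r e 0 [ a ])
    (≋-trans (⊕-identityʳ _) (≋-reflexive (≡.cong (λ k → mon K a (r k)) (ℕ.+-identityʳ e))))

  reindex-reindex : ∀ s r i X → reindex s 0 (reindex r i X) ≋ reindex (s ∘ r) i X
  reindex-reindex s r i []      = ≋-refl
  reindex-reindex s r i (a ∷ X) = ≋-trans (reindex-⊕ s 0 (mon K a (r i)) (reindex r (suc i) X))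
    (⊕-cong (reindex-mon s a (r i)) (reindex-reindex s r (suc i) X))

  reindex-identity : ∀ r i X → (∀ j → j < i ℕ.+ length X → r j ≡ j) → reindex r i X ≋ shiftⁿ i X
  reindex-identity r i []      _     = ≋-sym (shiftⁿ-[] i)
  reindex-identity r i (a ∷ X) r≗id = ≋-trans
    (⊕-cong (≋-reflexive (≡.cong (mon K a) (r≗id i i<))) (reindex-identity r (suc i) X r≗id′))
    (≋-sym (shiftⁿ-∷ i a X))
    where
    i< : i < i ℕ.+ suc (length X)
    i< = ℕ.m<m+n i (s≤s z≤n)
    r≗id′ : ∀ j → j < suc i ℕ.+ length X → r j ≡ j
    r≗id′ j j< = r≗id j (≡.subst (j <_) (≡.sym (ℕ.+-suc i (length X))) j<)

  reindex-suc : ∀ r i X → reindex r (suc i) X ≡ reindex (r ∘ suc) i X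
  reindex-suc r i []      = ≡.refl
  reindex-suc r i (a ∷ X) = ≡.cong (mon K a (r (suc i)) ⊕_) (reindex-suc r (suc i) X)

  coeff-reindex-∉ : ∀ r X d → (∀ j → j < length X → r j ≢ d) → coeff K (reindex r 0 X) d ≈ 0#
  coeff-reindex-∉ r []      d _     = refl
  coeff-reindex-∉ r (a ∷ X) d r≢d = begin
    coeff K (mon K a (r 0) ⊕ reindex r 1 X) d                ≈⟨ coeff-⊕ (mon K a (r 0)) _ d ⟩
    coeff K (mon K a (r 0)) d + coeff K (reindex r 1 X) d    ≡⟨ ≡.cong (λ Y → _ + coeff K Y d) (reindex-suc r 0 X) ⟩
    coeff K (mon K a (r 0)) d + coeff K (reindex (r ∘ suc) 0 X) d
      ≈⟨ +-cong (coeff-mon-≢ a (r 0) d (λ d≡r0 → r≢d 0 (s≤s z≤n) (≡.sym d≡r0)))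
                (coeff-reindex-∉ (r ∘ suc) X d (λ j j< → r≢d (suc j) (s≤s j<))) ⟩
    0# + 0#                                                  ≈⟨ +-identityˡ 0# ⟩
    0#                                                       ∎
    where open SetoidReasoning setoid

  coeff-reindex : ∀ r X d t → (∀ j → j < length X → r j ≡ d → j ≡ t) → r t ≡ d →
                  coeff K (reindex r 0 X) d ≈ coeff K X t
  coeff-reindex r []      d t       _      _    = refl
  coeff-reindex r (a ∷ X) d t uniq rt≡d = begin
    coeff K (mon K a (r 0) ⊕ reindex r 1 X) d                       ≈⟨ coeff-⊕ (mon K a (r 0)) _ d ⟩
    coeff K (mon K a (r 0)) d + coeff K (reindex r 1 X) d           ≡⟨ ≡.cong (λ Y → _ + coeff K Y d) (reindex-suc r 0 X) ⟩
    coeff K (mon K a (r 0)) d + coeff K (reindex (r ∘ suc) 0 X) d   ≈⟨ split t uniq rt≡d ⟩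
    coeff K (a ∷ X) t                                               ∎
    where
    open SetoidReasoning setoid
    split : ∀ t → (∀ j → j < suc (length X) → r j ≡ d → j ≡ t) → r t ≡ d →
            coeff K (mon K a (r 0)) d + coeff K (reindex (r ∘ suc) 0 X) d ≈ coeff K (a ∷ X) t
    split zero    uniq r0≡d = begin
      coeff K (mon K a (r 0)) d + coeff K (reindex (r ∘ suc) 0 X) d
        ≈⟨ +-cong (reflexive (≡.subst (λ e → coeff K (mon K a (r 0)) e ≡ a) r0≡d (coeff-mon a (r 0))))
                  (coeff-reindex-∉ (r ∘ suc) X d (λ j j< r[1+j]≡d → ℕ.1+n≢0 (uniq (suc j) (s≤s j<) r[1+j]≡d))) ⟩
      a + 0#                                                        ≈⟨ +-identityʳ a ⟩
      a                                                             ∎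
    split (suc t) uniq rt≡d = begin
      coeff K (mon K a (r 0)) d + coeff K (reindex (r ∘ suc) 0 X) d
        ≈⟨ +-cong (coeff-mon-≢ a (r 0) d (λ d≡r0 → ℕ.1+n≢0 (≡.sym (uniq 0 (s≤s z≤n) (≡.sym d≡r0)))))
                  (coeff-reindex (r ∘ suc) X d t (λ j j< r[1+j]≡d → ℕ.suc-injective (uniq (suc j) (s≤s j<) r[1+j]≡d)) rt≡d) ⟩
      0# + coeff K X t                                              ≈⟨ +-identityˡ _ ⟩
      coeff K X t                                                   ∎

module FrobeniusFixedPolynomial {c ℓ} (K : CommutativeRing c ℓ) {p k n : ℕ} (p-prime : Prime p) (1≤k : 1 ≤ k)
  (finiteField : IsFiniteFieldOfSize K ((p ℕ.^ k) ℕ.^ suc n)) where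
  open CommutativeRing K hiding (zero)
  open import Algebra.Properties.Semiring.Exp semiring using (_^_)
  open Polynomial K
  open Reindexing K

  q N Q : ℕ
  q = p ℕ.^ k
  Q = q ℕ.^ n
  N = q ℕ.^ suc n

  private
    ^-≥-base : ∀ m .{{_ : ℕ.NonZero m}} {j} → 1 ≤ j → m ≤ m ℕ.^ j
    ^-≥-base m 1≤j = ℕ.≤-trans (ℕ.≤-reflexive (≡.sym (ℕ.*-identityʳ m))) (ℕ.^-monoʳ-≤ m 1≤j)

  1<q : 1 < q
  1<q = ℕ.<-≤-trans (prime>1 p-prime) (^-≥-base p {{prime⇒nonZero p-prime}} 1≤k)

  1<N : 1 < N
  1<N = ℕ.<-≤-trans 1<q (^-≥-base q {{ℕ.>-nonZero (ℕ.<-trans (s≤s z≤n) 1<q)}} {suc n} (s≤s z≤n))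

  open ExponentReduction N 1<N
  open FiniteCommutativeRing K (proj₂ finiteField) using (^≈0⇒≈0; frobenius-injective; characteristic)

  private
    isField = proj₁ finiteField
    N≡p^[k*[1+n]] : N ≡ p ℕ.^ (k ℕ.* suc n)
    N≡p^[k*[1+n]] = ℕ.^-*-assoc p k (suc n)

  pow≈^ : ∀ x m → pow K x m ≈ x ^ m
  pow≈^ x zero    = refl
  pow≈^ x (suc m) = *-congˡ (pow≈^ x m)

  pow-q-injective : ∀ x y → pow K x q ≈ pow K y q → x ≈ y
  pow-q-injective x y xᵠ≈yᵠ = frobenius-injective isField {m = k ℕ.* suc n} p-prime N≡p^[k*[1+n]] k x y
    (trans (sym (pow≈^ x q)) (trans xᵠ≈yᵠ (pow≈^ y q)))

  pow-q≈0⇒≈0 : ∀ x → pow K x q ≈ 0# → x ≈ 0#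
  pow-q≈0⇒≈0 x xᵠ≈0 = ^≈0⇒≈0 isField x q (trans (sym (pow≈^ x q)) xᵠ≈0)

  pow-0#-q : pow K 0# q ≈ 0#
  pow-0#-q with q | 1<q
  ... | suc _ | _ = zeroˡ _

  pow-cong : ∀ {x y} m → x ≈ y → pow K x m ≈ pow K y m
  pow-cong zero    x≈y = refl
  pow-cong (suc m) x≈y = *-cong x≈y (pow-cong m x≈y)

  []^ₚq : _^ₚ_ K [] q ≋ []
  []^ₚq with q | 1<q
  ... | suc _ | _ = ≋-refl

  shiftⁿ-^ₚq : ∀ i X → _^ₚ_ K (shiftⁿ i X) q ≋ reindex (ℕ._* q) i (map (λ a → pow K a q) X)
  shiftⁿ-^ₚq i []      = ≋-trans (^ₚ-cong q (shiftⁿ-[] i)) []^ₚq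
  shiftⁿ-^ₚq i (a ∷ X) = ≋-trans (^ₚ-cong q (shiftⁿ-∷ i a X))
    (≋-trans (⊕-^ₚ-primePower p-prime (characteristic isField {m = k ℕ.* suc n} p-prime N≡p^[k*[1+n]]) k (mon K a i) (shiftⁿ (suc i) X))
      (⊕-cong (mon-^ₚ a i q) (shiftⁿ-^ₚq (suc i) X)))

  modX-cong : ∀ X Y → X ≋ Y → modX K N X ≋ modX K N Y
  modX-cong X Y X≋Y = ≋-trans (≋-reflexive (modX≡reindex N X))
    (≋-trans (reindex-cong (redExp K N) 0 X Y X≋Y) (≋-reflexive (≡.sym (modX≡reindex N Y))))

  modX-mon : ∀ a e → modX K N (mon K a e) ≋ mon K a (reduce e)
  modX-mon a e = ≋-trans (≋-reflexive (modX≡reindex N (mon K a e)))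
    (≋-trans (reindex-mon (redExp K N) a e) (≋-reflexive (≡.cong (mon K a) (redExp≡reduce K e))))

  modX-short : ∀ X → length X ≤ N → modX K N X ≋ X
  modX-short X X-short = ≋-trans (≋-reflexive (modX≡reindex N X))
    (reindex-identity (redExp K N) 0 X (λ j j<N → ≡.trans (redExp≡reduce K j) (reduce-fixes j (ℕ.<-≤-trans j<N X-short))))

  coeff-modX-^ₚq : ∀ X d t → length X ≤ N → t < N → reduce (t ℕ.* q) ≡ d →
                   coeff K (modX K N (_^ₚ_ K X q)) d ≈ pow K (coeff K X t) q
  coeff-modX-^ₚq X d t X-short t<N t↦d = begin
    coeff K (modX K N (_^ₚ_ K X q)) d                         ≡⟨ ≡.cong (λ Y → coeff K Y d) (modX≡reindex N (_^ₚ_ K X q)) ⟩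
    coeff K (reindex (redExp K N) 0 (_^ₚ_ K X q)) d           ≈⟨ coeff≈ (reindex-cong (redExp K N) 0 _ _ (shiftⁿ-^ₚq 0 X)) d ⟩
    coeff K (reindex (redExp K N) 0 (reindex (ℕ._* q) 0 Xᵠ)) d ≈⟨ coeff≈ (reindex-reindex (redExp K N) (ℕ._* q) 0 Xᵠ) d ⟩
    coeff K (reindex r 0 Xᵠ) d                                 ≈⟨ coeff-reindex r Xᵠ d t r-injective (≡.trans (redExp≡reduce K _) t↦d) ⟩
    coeff K Xᵠ t                                               ≈⟨ coeff-map (λ a → pow K a q) pow-0#-q X t ⟩
    pow K (coeff K X t) q                                      ∎
    where
    open SetoidReasoning setoid
    Xᵠ = map (λ a → pow K a q) X
    r = redExp K N ∘ (ℕ._* q)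
    r-injective : ∀ j → j < length Xᵠ → r j ≡ d → j ≡ t
    r-injective j j<len rj≡d = reduce-*-injective ≡.refl
      (ℕ.<-≤-trans (≡.subst (j <_) (length-map _ X) j<len) X-short) t<N
      (≡.trans (≡.sym (redExp≡reduce K _)) (≡.trans rj≡d (≡.sym t↦d)))

  module _ (F : Poly K) (F-fixed : _≈ₚ_ K (modX K N (_^ₚ_ K F q)) (modX K N F)) (F-short : length F ≤ N) where

    coeff-root : ∀ t d β → t < N → reduce (t ℕ.* q) ≡ d → pow K β q ≈ coeff K F d → coeff K F t ≈ β
    coeff-root t d β t<N t↦d βᵠ≈F[d] = pow-q-injective _ _ (begin
      pow K (coeff K F t) q              ≈⟨ coeff-modX-^ₚq F d t F-short t<N t↦d ⟨
      coeff K (modX K N (_^ₚ_ K F q)) d  ≈⟨ F-fixed d ⟩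
      coeff K (modX K N F) d             ≈⟨ coeff≈ (modX-short F F-short) d ⟩
      coeff K F d                        ≈⟨ βᵠ≈F[d] ⟨
      pow K β q                          ∎)
      where open SetoidReasoning setoid

    monomial-root : ∀ α e → ¬ (α ≈ 0#) →
      IsMonomialOf K (modX K N (_^ₚ_ K (mon K α e) q)) F → IsMonomialOf K (modX K N (mon K α e)) F
    monomial-root α e α≉0 (a , d , mᵠ≈axᵈ , _ , F[d]≈a) =
      α , reduce e , coeff≈ (modX-mon α e) , α≉0 ,
      coeff-root (reduce e) d α (reduce-< e) (≡.trans (reduce[reduce[e]*q]≡reduce[e*q] e q) e↦d) (trans αᵠ≈a (sym F[d]≈a))
      where
      mᵠ≋axᵈ : mon K (pow K α q) (reduce (e ℕ.* q)) ≋ mon K a d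
      mᵠ≋axᵈ = ≋-trans (≋-sym (≋-trans (modX-cong _ _ (mon-^ₚ α e q)) (modX-mon (pow K α q) (e ℕ.* q)))) (mk≋ mᵠ≈axᵈ)
      αᵠ≉0 : ¬ (pow K α q ≈ 0#)
      αᵠ≉0 = α≉0 ∘ pow-q≈0⇒≈0 α
      e↦d : reduce (e ℕ.* q) ≡ d
      e↦d = proj₁ (mon-injective _ _ αᵠ≉0 mᵠ≋axᵈ)
      αᵠ≈a : pow K α q ≈ a
      αᵠ≈a = proj₂ (mon-injective _ _ αᵠ≉0 mᵠ≋axᵈ)

    term-root : ∀ α j → IsTermOf K α (j ℕ.* q ℕ.+ 1) F → ∀ β → pow K β q ≈ α → IsTermOf K β (j ℕ.+ Q) F
    term-root α j (α≉0 , F[d]≈α) β βᵠ≈α =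
      β≉0 , coeff-root (j ℕ.+ Q) d β j+Q<N (reduce[[k+Q]*q]≡k*q+1 ≡.refl j d<N) (trans βᵠ≈α (sym F[d]≈α))
      where
      d = j ℕ.* q ℕ.+ 1
      d<N : d < N
      d<N = ℕ.<-≤-trans (coeff-≉0⇒<length F d (λ F[d]≈0 → α≉0 (trans (sym F[d]≈α) F[d]≈0))) F-short
      j+Q<N : j ℕ.+ Q < N
      j+Q<N = k*q+1<N⇒k+Q<N ≡.refl 1<q j d<N
      β≉0 : ¬ (β ≈ 0#)
      β≉0 β≈0 = α≉0 (trans (sym βᵠ≈α) (trans (pow-cong q β≈0) pow-0#-q))

open import Data.Nat using (_^_; _*_; _+_)
open import Data.Product using (_×_)

lemma4p3 : ∀ {c ℓ : Level} (q n : ℕ) → IsPrimePower q → 1 ≤ n →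
    (K : CommutativeRing c ℓ) → IsFiniteFieldOfSize K (q ^ n) →
    (F : Poly K) →
    _≈ₚ_ K (modX K (q ^ n) (_^ₚ_ K F q)) (modX K (q ^ n) F) →
    length F ≤ q ^ n →
    -- (a)
    (∀ (α : CommutativeRing.Carrier K) (e : ℕ) → ¬ (CommutativeRing._≈_ K α (CommutativeRing.0# K)) →
      IsMonomialOf K (modX K (q ^ n) (_^ₚ_ K (mon K α e) q)) F →
      IsMonomialOf K (modX K (q ^ n) (mon K α e)) F)
    ×
    -- (b)
    (∀ (α : CommutativeRing.Carrier K) (k : ℕ) → IsTermOf K α (k * q + 1) F →
      ∀ (β : CommutativeRing.Carrier K) → CommutativeRing._≈_ K (pow K β q) α →
      IsTermOf K β (k + q ^ (n ∸ 1)) F)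
lemma4p3 .(p ^ k) (suc n) (p , k , p-prime , 1≤k , ≡.refl) (s≤s z≤n) K finiteField F F-fixed F-short =
  monomial-root F F-fixed F-short , term-root F F-fixed F-short
  where open FrobeniusFixedPolynomial K {n = n} p-prime 1≤k finiteField
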